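{- (1) If $\cdot;\Gamma'\vdash t:T$ holds in the Kripke-style idempotent S4 system, then $\Gamma'\vdash t:T$ holds in the Fitch-style idempotent S4 system. (2) If $\Delta;\Gamma'\vdash t:T$ holds in the Kripke-style system and the Fitch context $\Gamma$ is more complex than $\Delta$, then $\Gamma,\text{lock},\Gamma'\vdash t:T$ holds in the Fitch-style system.
   Context: Types $T::=B\mid\square T\mid S\longrightarrow T$; terms $t::=x\mid\mathsf{box}\,t\mid\mathsf{unbox}\,t\mid\lambda x.t\mid s\ t$ (names, up to $\alpha$). Fitch-style contexts: $\Gamma::=\cdot\mid\Gamma,x:T\mid\Gamma,\text{lock}$; $\Gamma^{\text{lock}}$ denotes $\Gamma$ with all locks removed. Fitch-style idempotent S4 judgment $\Gamma\vdash t:T$: if $\Gamma=\Gamma_1,x:T,\Gamma_2$ where $\Gamma_2$ contains no lock, then $\Gamma\vdash x:T$; if $\Gamma,\text{lock}\vdash t:T$ then $\Gamma\vdash\mathsf{box}\,t:\square T$; if $\Gamma^{\text{lock}}\vdash t:\square T$ then $\Gamma\vdash\mathsf{unbox}\,t:T$; if $\Gamma,x:S\vdash t:T$ then $\Gamma\vdash\lambda x.t:S\longrightarrow T$; if $\Gamma\vdash t:S\longrightarrow T$ and $\Gamma\vdash s:S$ then $\Gamma\vdash t\ s:T$. Kripke-style idempotent S4 judgment $\Delta;\Delta'\vdash t:T$ (lock-free contexts): if $x:T\in\Delta'$ then $\Delta;\Delta'\vdash x:T$; if $(\Delta,\Delta');\cdot\vdash t:T$ then $\Delta;\Delta'\vdash\mathsf{box}\,t:\square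 T$; if $\cdot;(\Delta,\Delta')\vdash t:\square T$ then $\Delta;\Delta'\vdash\mathsf{unbox}\,t:T$; if $\Delta;(\Delta',x:S)\vdash t:T$ then $\Delta;\Delta'\vdash\lambda x.t:S\longrightarrow T$; if $\Delta;\Delta'\vdash t:S\longrightarrow T$ and $\Delta;\Delta'\vdash s:S$ then $\Delta;\Delta'\vdash t\ s:T$. A Fitch context $\Gamma$ is more complex than a lock-free context $\Delta$ if $\Gamma$ is obtained from $\Delta$ by inserting any number of locks. -}

module Defs where

open import Data.Nat using (ℕ)
open import Data.Product using (Σ; _×_; ∃-syntax)
open import Relation.Binary.PropositionalEquality using (_≡_)

Name : Set
Name = ℕ

data Ty : Set where
  B    : Ty
  □_   : Ty → Ty
  _⟶_ : Ty → Ty → Ty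

infixr 20 _⟶_

data Tm : Set where
  var   : Name → Tm
  box   : Tm → Tm
  unbox : Tm → Tm
  lam   : Name → Tm → Tm
  app   : Tm → Tm → Tm

data FCtx : Set where
  ·     : FCtx
  _,_∶_ : FCtx → Name → Ty → FCtx
  _,🔒  : FCtx → FCtx

data Ctx : Set where
  ∅     : Ctx
  _,_∶_ : Ctx → Name → Ty → Ctx

_++_ : FCtx → FCtx → FCtx
Γ ++ ·           = Γ
Γ ++ (Γ' , x ∶ T) = (Γ ++ Γ') , x ∶ T
Γ ++ (Γ' ,🔒)     = (Γ ++ Γ') ,🔒

_⧺_ : Ctx → Ctx → Ctx
Δ ⧺ ∅           = Δ
Δ ⧺ (Δ' , x ∶ T) = (Δ ⧺ Δ') , x ∶ T

⌜_⌝ : Ctx → FCtx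
⌜ ∅ ⌝         = ·
⌜ Δ , x ∶ T ⌝ = ⌜ Δ ⌝ , x ∶ T

unlock : FCtx → FCtx
unlock ·           = ·
unlock (Γ , x ∶ T) = unlock Γ , x ∶ T
unlock (Γ ,🔒)     = unlock Γ

data LockFree : FCtx → Set where
  lf·  : LockFree ·
  lf,  : ∀ {Γ x T} → LockFree Γ → LockFree (Γ , x ∶ T)

data _∶_∈_ : Name → Ty → Ctx → Set where
  here  : ∀ {Δ x T} → x ∶ T ∈ (Δ , x ∶ T)
  there : ∀ {Δ x T y S} → x ∶ T ∈ Δ → x ∶ T ∈ (Δ , y ∶ S)

infix 4 _⊢F_∶_ _⨾_⊢K_∶_

data _⊢F_∶_ : FCtx → Tm → Ty → Set where
  F-var   : ∀ {Γ₁ Γ₂ x T} → LockFree Γ₂ →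
            ((Γ₁ , x ∶ T) ++ Γ₂) ⊢F var x ∶ T
  F-box   : ∀ {Γ t T} → (Γ ,🔒) ⊢F t ∶ T → Γ ⊢F box t ∶ □ T
  F-unbox : ∀ {Γ t T} → unlock Γ ⊢F t ∶ □ T → Γ ⊢F unbox t ∶ T
  F-lam   : ∀ {Γ x t S T} → (Γ , x ∶ S) ⊢F t ∶ T → Γ ⊢F lam x t ∶ (S ⟶ T)
  F-app   : ∀ {Γ t s S T} → Γ ⊢F t ∶ (S ⟶ T) → Γ ⊢F s ∶ S → Γ ⊢F app t s ∶ T

data _⨾_⊢K_∶_ : Ctx → Ctx → Tm → Ty → Set where
  K-var   : ∀ {Δ Δ' x T} → x ∶ T ∈ Δ' → Δ ⨾ Δ' ⊢K var x ∶ T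
  K-box   : ∀ {Δ Δ' t T} → (Δ ⧺ Δ') ⨾ ∅ ⊢K t ∶ T → Δ ⨾ Δ' ⊢K box t ∶ □ T
  K-unbox : ∀ {Δ Δ' t T} → ∅ ⨾ (Δ ⧺ Δ') ⊢K t ∶ □ T → Δ ⨾ Δ' ⊢K unbox t ∶ T
  K-lam   : ∀ {Δ Δ' x t S T} → Δ ⨾ (Δ' , x ∶ S) ⊢K t ∶ T → Δ ⨾ Δ' ⊢K lam x t ∶ (S ⟶ T)
  K-app   : ∀ {Δ Δ' t s S T} → Δ ⨾ Δ' ⊢K t ∶ (S ⟶ T) → Δ ⨾ Δ' ⊢K s ∶ S → Δ ⨾ Δ' ⊢K app t s ∶ T

data MoreComplex : FCtx → Ctx → Set where
  mc·    : MoreComplex · ∅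
  mc,    : ∀ {Γ Δ x T} → MoreComplex Γ Δ → MoreComplex (Γ , x ∶ T) (Δ , x ∶ T)
  mc🔒   : ∀ {Γ Δ} → MoreComplex Γ Δ → MoreComplex (Γ ,🔒) Δ

Claim1 : Set
Claim1 = ∀ {Γ' t T} → ∅ ⨾ Γ' ⊢K t ∶ T → ⌜ Γ' ⌝ ⊢F t ∶ T

Claim2 : Set
Claim2 = ∀ {Δ Γ' Γ t T} → Δ ⨾ Γ' ⊢K t ∶ T → MoreComplex Γ Δ →
         ((Γ ,🔒) ++ ⌜ Γ' ⌝) ⊢F t ∶ T

{-# OPTIONS --safe #-}
-- Both claims are instances of one translation, by induction on the Kripke
-- derivation: if Δ ⨾ Γ' ⊢K t ∶ T and Γ is more complex than Δ (with or without
-- trailing locks), then Γ , Γ' ⊢F t ∶ T.  A Kripke variable lies in Γ', which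
-- stays lock-free, and for unbox the lock-erasure of Γ , Γ' is exactly Δ , Γ',
-- the context of the premise, retranslated with the empty outer context.
module Submission where

open import Defs
open import Data.Product using (_×_; _,_; ∃-syntax)
open import Relation.Binary.PropositionalEquality using (_≡_; refl; cong; sym; subst; module ≡-Reasoning)

++-identityˡ : ∀ Γ → · ++ Γ ≡ Γ
++-identityˡ ·           = refl
++-identityˡ (Γ , x ∶ T) = cong (_, x ∶ T) (++-identityˡ Γ)
++-identityˡ (Γ ,🔒)     = cong _,🔒 (++-identityˡ Γ)

moreComplex-++ : ∀ {Γ Δ} Γ' → MoreComplex Γ Δ → MoreComplex (Γ ++ ⌜ Γ' ⌝) (Δ ⧺ Γ')
moreComplex-++ ∅            m = m
moreComplex-++ (Γ' , x ∶ T) m = mc, (moreComplex-++ Γ' m)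

unlock-moreComplex : ∀ {Γ Δ} → MoreComplex Γ Δ → unlock Γ ≡ ⌜ Δ ⌝
unlock-moreComplex mc·      = refl
unlock-moreComplex (mc, m)  = cong (_, _ ∶ _) (unlock-moreComplex m)
unlock-moreComplex (mc🔒 m) = unlock-moreComplex m

∈-lockFree-split : ∀ {x T Γ'} Γ → x ∶ T ∈ Γ' →
  ∃[ Γ₁ ] ∃[ Γ₂ ] LockFree Γ₂ × Γ ++ ⌜ Γ' ⌝ ≡ (Γ₁ , x ∶ T) ++ Γ₂
∈-lockFree-split {Γ' = Γ' , _ ∶ _} Γ here = Γ ++ ⌜ Γ' ⌝ , · , lf· , refl
∈-lockFree-split Γ (there {y = y} {S = S} x∈) with ∈-lockFree-split Γ x∈
... | Γ₁ , Γ₂ , lf , eq = Γ₁ , (Γ₂ , y ∶ S) , lf, lf , cong (_, y ∶ S) eq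

⊢F-∈ : ∀ {x T Γ'} Γ → x ∶ T ∈ Γ' → Γ ++ ⌜ Γ' ⌝ ⊢F var x ∶ T
⊢F-∈ Γ x∈ with ∈-lockFree-split Γ x∈
... | _ , _ , lf , eq = subst (_⊢F var _ ∶ _) (sym eq) (F-var lf)

kripke⇒fitch : ∀ {Δ Γ' Γ t T} → Δ ⨾ Γ' ⊢K t ∶ T → MoreComplex Γ Δ →
               Γ ++ ⌜ Γ' ⌝ ⊢F t ∶ T
kripke⇒fitch {Γ = Γ} (K-var x∈) m = ⊢F-∈ Γ x∈
kripke⇒fitch {Γ' = Γ'} (K-box d) m = F-box (kripke⇒fitch d (mc🔒 (moreComplex-++ Γ' m)))
kripke⇒fitch {Δ} {Γ'} {Γ} (K-unbox d) m = F-unbox (subst (_⊢F _ ∶ _) erasure (kripke⇒fitch d mc·))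
  where
  open ≡-Reasoning
  erasure : · ++ ⌜ Δ ⧺ Γ' ⌝ ≡ unlock (Γ ++ ⌜ Γ' ⌝)
  erasure = begin
    · ++ ⌜ Δ ⧺ Γ' ⌝          ≡⟨ ++-identityˡ _ ⟩
    ⌜ Δ ⧺ Γ' ⌝               ≡⟨ sym (unlock-moreComplex (moreComplex-++ Γ' m)) ⟩
    unlock (Γ ++ ⌜ Γ' ⌝)     ∎
kripke⇒fitch (K-lam d)   m = F-lam (kripke⇒fitch d m)
kripke⇒fitch (K-app d e) m = F-app (kripke⇒fitch d m) (kripke⇒fitch e m)

lemma4p4 : Claim1 × Claim2
lemma4p4 = (λ {Γ'} d → subst (_⊢F _ ∶ _) (++-identityˡ ⌜ Γ' ⌝) (kripke⇒fitch d mc·))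
         , (λ d m → kripke⇒fitch d (mc🔒 m))
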